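{- For a digraph $G$ with $n$ vertices, the total number of vertices in all vertex-resilient blocks, $\sum_B |B|$ over all vertex-resilient blocks $B$, is at most $2n-2$.
   Context: Let $G=(V,E)$ be a digraph. Two distinct vertices $v,w$ are vertex-resilient, written $v\leftrightarrow_{\mathrm{vr}} w$, if for every vertex $z\notin\{v,w\}$, $v$ and $w$ lie in the same strongly connected component of $G\setminus z$. A vertex-resilient block is a maximal set $B\subseteq V$ with $|B|\ge 2$ such that $u\leftrightarrow_{\mathrm{vr}} v$ for all distinct $u,v\in B$. -}

module Defs where

open import Data.Nat using (ℕ; _≤_; _*_; _∸_)
open import Data.Fin using (Fin)
open import Data.Fin.Subset using (Subset; _∈_; _⊆_; ∣_∣)
open import Data.Product using (_×_)
open import Relation.Binary.PropositionalEquality using (_≡_; _≢_)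
open import Relation.Binary.Construct.Closure.ReflexiveTransitive using (Star)

Digraph : ℕ → Set₁
Digraph n = Fin n → Fin n → Set

_∖_ : ∀ {n} → Digraph n → Fin n → Digraph n
(G ∖ z) u v = G u v × u ≢ z × v ≢ z

Reach : ∀ {n} → Digraph n → Fin n → Fin n → Set
Reach G = Star G

SameSCC : ∀ {n} → Digraph n → Fin n → Fin n → Set
SameSCC G v w = Reach G v w × Reach G w v

VR : ∀ {n} → Digraph n → Fin n → Fin n → Set
VR G v w = v ≢ w × (∀ z → z ≢ v → z ≢ w → SameSCC (G ∖ z) v w)

PairwiseVR : ∀ {n} → Digraph n → Subset n → Set
PairwiseVR G B = ∀ u v → u ∈ B → v ∈ B → u ≢ v → VR G u v

IsVRBlock : ∀ {n} → Digraph n → Subset n → Set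
IsVRBlock {n} G B =
  (2 ≤ ∣ B ∣) × PairwiseVR G B ×
  (∀ (B′ : Subset n) → B ⊆ B′ → PairwiseVR G B′ → B′ ⊆ B)

module Submission where

-- Regard the blocks as hyperedges on the vertex set.  The key structural fact
-- is that this hypergraph is acyclic: two distinct vertices u, w of a block B
-- are never joined by a walk through other blocks (`no-detour`).  Indeed, cut
-- such a walk at its last step leaving u, through a block C to a vertex u′;
-- the rest of the walk avoids u, so u′ and w are strongly connected in G ∖ u.
-- Then B ∪ C is pairwise vertex-resilient (`glued-union-pairwiseVR`), and
-- maximality forces B = C (`union-of-blocks`), a contradiction.
--
-- Acyclicity is turned into a count with union-find labellings: idempotent
-- maps f : Fin n → Fin n whose classes are connected, the number of classes
-- being the number of fixed points.  Starting from the identity (n classes)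
-- we absorb the blocks one at a time; absorbing B joins each of its vertices
-- to the class of a base vertex b₀, and acyclicity shows that each of these
-- |B| − 1 joins merges two different classes.  As one class always remains,
-- Σ_B (|B| − 1) ≤ n − 1, and |B| ≤ 2(|B| − 1) for |B| ≥ 2 finishes the proof.

open import Defs
open import Data.Nat using (ℕ; _≤_; _*_; _∸_)
open import Data.Fin.Subset using (Subset; ∣_∣)
open import Data.List using (List; map)
open import Data.Nat.ListAction using (sum)
open import Data.List.Relation.Unary.All using (All)
open import Data.List.Relation.Unary.Unique.Propositional using (Unique)

open import Data.Nat using (zero; suc; _+_; z≤n; s≤s)
import Data.Nat.Properties as ℕ
open import Data.Fin using (Fin; zero; suc; _≟_; punchIn)
open import Data.Fin.Properties using (suc-injective; punchInᵢ≢i; 0≢1+n)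
open import Data.Fin.Subset using (_∈_; _⊆_; _∪_; inside; outside)
open import Data.Fin.Subset.Properties using (_∈?_; drop-there; x∈p∪q⁻; x∈p∪q⁺; p⊆p∪q; ⊆-antisym; ∪-comm)
open import Data.Vec using ([]; _∷_; here; there)
open import Data.List using ([]; _∷_)
open import Data.List.Membership.Propositional using () renaming (_∈_ to _∈ₗ_)
open import Data.List.Relation.Unary.All using ([]; _∷_; lookup) renaming (map to all-map)
open import Data.List.Relation.Unary.Any using (here; there)
open import Data.List.Relation.Unary.AllPairs using (_∷_)
open import Data.Product using (Σ; _×_; _,_; proj₁; proj₂)
open import Data.Sum using (_⊎_; inj₁; inj₂)
open import Function using (_∘_; id)
open import Function.Definitions using (Injective)
open import Relation.Nullary using (¬_; Dec; yes; no; contradiction)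
open import Relation.Nullary.Decidable using (_×-dec_; ¬?)
open import Relation.Binary.PropositionalEquality using (_≡_; _≢_; refl; sym; trans; cong; subst; module ≡-Reasoning)
open import Relation.Binary.Construct.Closure.ReflexiveTransitive as Star using (Star; ε; _◅_; _◅◅_)
open import Algebra.Properties.CommutativeMonoid.Sum ℕ.+-0-commutativeMonoid
  using (sum-cong-≗; sum-remove) renaming (sum to ∑)

indicator : ∀ {A : Set} → Dec A → ℕ
indicator (yes _) = 1
indicator (no _) = 0

indicator≤1 : ∀ {A : Set} (d : Dec A) → indicator d ≤ 1
indicator≤1 (yes _) = s≤s z≤n
indicator≤1 (no _) = z≤n

indicator-yes : ∀ {A : Set} → A → (d : Dec A) → indicator d ≡ 1
indicator-yes a (yes _) = refl
indicator-yes a (no ¬a) = contradiction a ¬a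

indicator-no : ∀ {A : Set} → ¬ A → (d : Dec A) → indicator d ≡ 0
indicator-no ¬a (yes a) = contradiction a ¬a
indicator-no ¬a (no _) = refl

indicator-cong : ∀ {A B : Set} → (A → B) → (B → A) → (d : Dec A) (e : Dec B) →
                 indicator d ≡ indicator e
indicator-cong f g (yes a) e = sym (indicator-yes (f a) e)
indicator-cong f g (no ¬a) e = sym (indicator-no (λ b → ¬a (g b)) e)

∑-bounded : ∀ {n} (t : Fin n → ℕ) → (∀ i → t i ≤ 1) → ∑ t ≤ n
∑-bounded {zero} t t≤1 = z≤n
∑-bounded {suc n} t t≤1 = ℕ.+-mono-≤ (t≤1 zero) (∑-bounded (t ∘ suc) (t≤1 ∘ suc))

term≤∑ : ∀ {n} (t : Fin n → ℕ) (i : Fin n) → t i ≤ ∑ t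
term≤∑ {suc n} t i = subst (t i ≤_) (sym (sum-remove t)) (ℕ.m≤m+n (t i) _)

∑-raise : ∀ {n} (t s : Fin n → ℕ) (a : Fin n) → (∀ i → i ≢ a → t i ≡ s i) →
          t a ≡ 0 → s a ≡ 1 → suc (∑ t) ≡ ∑ s
∑-raise {suc n} t s a agree ta≡0 sa≡1 = begin
  suc (∑ t)                     ≡⟨ cong suc (sum-remove t) ⟩
  suc (t a + ∑ (t ∘ punchIn a)) ≡⟨ cong (λ k → suc (k + ∑ (t ∘ punchIn a))) ta≡0 ⟩
  suc (∑ (t ∘ punchIn a))       ≡⟨ cong suc (sum-cong-≗ (λ i → agree (punchIn a i) (punchInᵢ≢i a i))) ⟩
  suc (∑ (s ∘ punchIn a))       ≡⟨ cong (_+ ∑ (s ∘ punchIn a)) (sym sa≡1) ⟩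
  s a + ∑ (s ∘ punchIn a)       ≡⟨ sym (sum-remove s) ⟩
  ∑ s                           ∎
  where open ≡-Reasoning

∣∣≡∑ : ∀ {n} (B : Subset n) → ∣ B ∣ ≡ ∑ (λ x → indicator (x ∈? B))
∣∣≡∑ [] = refl
∣∣≡∑ (inside ∷ B) = cong suc (trans (∣∣≡∑ B) (sum-cong-≗ (λ x → indicator-cong there drop-there (x ∈? B) _)))
∣∣≡∑ (outside ∷ B) = trans (∣∣≡∑ B) (sum-cong-≗ (λ x → indicator-cong there drop-there (x ∈? B) _))

element : ∀ {n} (B : Subset n) → 1 ≤ ∣ B ∣ → Σ (Fin n) (_∈ B)
element (inside ∷ B) _ = zero , here
element (outside ∷ B) 1≤∣B∣ with element B 1≤∣B∣
... | x , x∈B = suc x , there x∈B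

scc-refl : ∀ {n} {G : Digraph n} {x} → SameSCC G x x
scc-refl = ε , ε

scc-sym : ∀ {n} {G : Digraph n} {x y} → SameSCC G x y → SameSCC G y x
scc-sym (x→y , y→x) = y→x , x→y

scc-trans : ∀ {n} {G : Digraph n} {x y w} → SameSCC G x y → SameSCC G y w → SameSCC G x w
scc-trans (x→y , y→x) (y→w , w→y) = x→y ◅◅ y→w , w→y ◅◅ y→x

-- Two vertices are linked by a family 𝒞 of vertex sets when some member of
-- 𝒞 contains both; walks of this relation are walks in the hypergraph 𝒞.
Linked : ∀ {n} → (Subset n → Set) → Fin n → Fin n → Set
Linked {n} 𝒞 a b = Σ (Subset n) λ C → 𝒞 C × a ∈ C × b ∈ C

module _ {n : ℕ} (G : Digraph n) where

  block-scc : ∀ {B} → IsVRBlock G B → ∀ {z p q} → p ∈ B → q ∈ B → z ≢ p → z ≢ q →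
              SameSCC (G ∖ z) p q
  block-scc (_ , pairwise , _) {z} {p} {q} p∈B q∈B z≢p z≢q with p ≟ q
  ... | yes refl = scc-refl
  ... | no p≢q = proj₂ (pairwise p q p∈B q∈B p≢q) z z≢p z≢q

  union-of-blocks : ∀ {B C} → IsVRBlock G B → IsVRBlock G C → PairwiseVR G (B ∪ C) → B ≡ C
  union-of-blocks {B} {C} (_ , _ , maxB) (_ , _ , maxC) pairwise = ⊆-antisym B⊆C C⊆B
    where
    B⊆C : B ⊆ C
    B⊆C x∈B = maxC (C ∪ B) (p⊆p∪q B) (subst (PairwiseVR G) (∪-comm B C) pairwise) (x∈p∪q⁺ (inj₂ x∈B))
    C⊆B : C ⊆ B
    C⊆B x∈C = maxB (B ∪ C) (p⊆p∪q C) pairwise (x∈p∪q⁺ (inj₂ x∈C))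

  -- After deleting z ≠ u,
  -- every vertex of B ∪ C reaches u; after deleting u, it reaches w.
  glued-union-pairwiseVR : ∀ {B C u w u′} → IsVRBlock G B → IsVRBlock G C →
    u ∈ B → u ∈ C → w ∈ B → u′ ∈ C → u ≢ w → u ≢ u′ → SameSCC (G ∖ u) u′ w →
    PairwiseVR G (B ∪ C)
  glued-union-pairwiseVR {B} {C} {u} {w} bB bC u∈B u∈C w∈B u′∈C u≢w u≢u′ u′~w p q p∈ q∈ p≢q =
    p≢q , resilient
    where
    toU : ∀ {z x} → z ≢ u → x ∈ B ⊎ x ∈ C → z ≢ x → SameSCC (G ∖ z) x u
    toU z≢u (inj₁ x∈B) z≢x = block-scc bB x∈B u∈B z≢x z≢u
    toU z≢u (inj₂ x∈C) z≢x = block-scc bC x∈C u∈C z≢x z≢u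

    toW : ∀ {x} → x ∈ B ⊎ x ∈ C → u ≢ x → SameSCC (G ∖ u) x w
    toW (inj₁ x∈B) u≢x = block-scc bB x∈B w∈B u≢x u≢w
    toW (inj₂ x∈C) u≢x = scc-trans (block-scc bC x∈C u′∈C u≢x u≢u′) u′~w

    resilient : ∀ z → z ≢ p → z ≢ q → SameSCC (G ∖ z) p q
    resilient z z≢p z≢q with z ≟ u
    ... | no z≢u = scc-trans (toU z≢u (x∈p∪q⁻ B C p∈) z≢p) (scc-sym (toU z≢u (x∈p∪q⁻ B C q∈) z≢q))
    ... | yes refl = scc-trans (toW (x∈p∪q⁻ B C p∈) z≢p) (scc-sym (toW (x∈p∪q⁻ B C q∈) z≢q))

  -- The last exit from u of a walk through the blocks 𝒞 ending at w: the
  -- block of 𝒞 used for the last step leaving u, and the vertex `next` ≠ u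
  -- reached by it, which the rest of the walk, avoiding u, keeps in one SCC
  -- of G ∖ u with w.
  record LastExit (𝒞 : Subset n → Set) (u w : Fin n) : Set where
    field
      block : Subset n
      in-family : 𝒞 block
      u∈block : u ∈ block
      next : Fin n
      next∈block : next ∈ block
      u≢next : u ≢ next
      next~w : SameSCC (G ∖ u) next w

  last-exit : ∀ {𝒞} → (∀ {C} → 𝒞 C → IsVRBlock G C) → ∀ u {x w} → u ≢ w →
              Star (Linked 𝒞) x w → (u ≢ x × SameSCC (G ∖ u) x w) ⊎ LastExit 𝒞 u w
  last-exit blocks u u≢w ε = inj₁ (u≢w , scc-refl)
  last-exit blocks u u≢w (_◅_ {x} {x′} step rest) with last-exit blocks u u≢w rest
  ... | inj₂ exit = inj₂ exit
  ... | inj₁ (u≢x′ , x′~w) with u ≟ x | step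
  ...   | yes refl | C , C∈𝒞 , u∈C , x′∈C = inj₂ (record
            { block = C ; in-family = C∈𝒞 ; u∈block = u∈C
            ; next = x′ ; next∈block = x′∈C ; u≢next = u≢x′ ; next~w = x′~w })
  ...   | no u≢x | C , C∈𝒞 , x∈C , x′∈C =
            inj₁ (u≢x , scc-trans (block-scc (blocks C∈𝒞) x∈C x′∈C u≢x u≢x′) x′~w)

  no-detour : ∀ {𝒞 B} → IsVRBlock G B → (∀ {C} → 𝒞 C → IsVRBlock G C × B ≢ C) →
              ∀ {u w} → u ∈ B → w ∈ B → u ≢ w → ¬ Star (Linked 𝒞) u w
  no-detour bB others {u} u∈B w∈B u≢w walk with last-exit (proj₁ ∘ others) u u≢w walk
  ... | inj₁ (u≢u , _) = u≢u refl
  ... | inj₂ exit =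
    let open LastExit exit
        bC , B≢C = others in-family
    in B≢C (union-of-blocks bB bC (glued-union-pairwiseVR bB bC u∈B u∈block w∈B next∈block u≢w u≢next next~w))

module _ {n : ℕ} where

  -- A union–find labelling for a relation R: f maps every vertex to the
  -- representative of its class, and vertices with equal labels are
  -- connected by an R-walk.
  record Labelling (R : Fin n → Fin n → Set) (f : Fin n → Fin n) : Set where
    field
      idempotent : ∀ x → f (f x) ≡ f x
      connected : ∀ x y → f x ≡ f y → Star R x y

  classes : (Fin n → Fin n) → ℕ
  classes f = ∑ (λ x → indicator (f x ≟ x))

  identity-labelling : ∀ {R} → Labelling R id
  identity-labelling = record { idempotent = λ _ → refl ; connected = λ { x .x refl → ε } }

  classes≤n : ∀ f → classes f ≤ n
  classes≤n f = ∑-bounded _ (λ x → indicator≤1 (f x ≟ x))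

  labelling-map : ∀ {R R′ f} → (∀ {a b} → R a b → R′ a b) → Labelling R f → Labelling R′ f
  labelling-map R⊆R′ L = record
    { idempotent = idempotent ; connected = λ x y fx≡fy → Star.map R⊆R′ (connected x y fx≡fy) }
    where open Labelling L

  classes-positive : ∀ {R f} → Labelling R f → Fin n → 1 ≤ classes f
  classes-positive {f = f} L x =
    subst (_≤ classes f) (indicator-yes (idempotent x) (f (f x) ≟ f x))
          (term≤∑ (λ y → indicator (f y ≟ y)) (f x))
    where open Labelling L

  relabel : (Fin n → Fin n) → Fin n → Fin n → Fin n → Fin n
  relabel f a c x with f x ≟ a
  ... | yes _ = c
  ... | no _ = f x

  module Join {R f} (L : Labelling R f) {u v : Fin n} (distinct : f u ≢ f v) where
    open Labelling L

    joined : Fin n → Fin n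
    joined = relabel f (f u) (f v)

    fixes-target : joined (f v) ≡ f v
    fixes-target with f (f v) ≟ f u
    ... | yes ffv≡fu = contradiction (trans (sym (idempotent v)) ffv≡fu) (distinct ∘ sym)
    ... | no _ = idempotent v

    joined-idempotent : ∀ x → joined (joined x) ≡ joined x
    joined-idempotent x with f x ≟ f u
    ... | yes _ = fixes-target
    ... | no fx≢fu with f (f x) ≟ f u
    ...   | yes ffx≡fu = contradiction (trans (sym (idempotent x)) ffx≡fu) fx≢fu
    ...   | no _ = idempotent x

    joined-connected : R u v → R v u → ∀ x y → joined x ≡ joined y → Star R x y
    joined-connected uv vu x y same with f x ≟ f u | f y ≟ f u
    ... | yes fx≡fu | yes fy≡fu = connected x y (trans fx≡fu (sym fy≡fu))
    ... | yes fx≡fu | no _ = connected x u fx≡fu ◅◅ uv ◅ connected v y same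
    ... | no _ | yes fy≡fu = connected x v same ◅◅ vu ◅ connected u y (sym fy≡fu)
    ... | no _ | no _ = connected x y same

    labelling : R u v → R v u → Labelling R joined
    labelling uv vu = record { idempotent = joined-idempotent ; connected = joined-connected uv vu }

    -- The fixed points are those of f except f u.
    one-class-fewer : suc (classes joined) ≡ classes f
    one-class-fewer = ∑-raise _ _ (f u) same-elsewhere lost-fu kept-fu
      where
      same-elsewhere : ∀ x → x ≢ f u → indicator (joined x ≟ x) ≡ indicator (f x ≟ x)
      same-elsewhere x x≢fu with f x ≟ f u
      ... | yes fx≡fu =
        trans (indicator-no (λ fv≡x → distinct (trans (sym fx≡fu) (trans (cong f (sym fv≡x)) (idempotent v)))) _)
              (sym (indicator-no (λ fx≡x → x≢fu (trans (sym fx≡x) fx≡fu)) _))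
      ... | no _ = refl
      lost-fu : indicator (joined (f u) ≟ f u) ≡ 0
      lost-fu with f (f u) ≟ f u
      ... | yes _ = indicator-no (distinct ∘ sym) _
      ... | no ffu≢fu = contradiction (idempotent u) ffu≢fu
      kept-fu : indicator (f (f u) ≟ f u) ≡ 1
      kept-fu = indicator-yes (idempotent u) _

-- If the classes of a labelling and k further units together number at most
-- n, then k ≤ n − 1, since at least one class exists.
merges-bound : ∀ {n R} {f : Fin n → Fin n} k → Labelling R f → classes f + k ≤ n → k ≤ n ∸ 1
merges-bound {zero} {f = f} k L bound = ℕ.m+n≤o⇒n≤o (classes f) bound
merges-bound {suc m} {f = f} k L bound = ℕ.≤-pred (begin
  suc k           ≡⟨ ℕ.+-comm 1 k ⟩
  k + 1           ≤⟨ ℕ.+-monoʳ-≤ k (classes-positive L zero) ⟩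
  k + classes f   ≡⟨ ℕ.+-comm k (classes f) ⟩
  classes f + k   ≤⟨ bound ⟩
  suc m           ∎)
  where open ℕ.≤-Reasoning

WithClique : ∀ {n} → (Fin n → Set) → (Fin n → Fin n → Set) → Fin n → Fin n → Set
WithClique P R a b = (P a × P b) ⊎ R a b

-- A walk that starts in P is, from the last clique vertex it visits, an R-walk.
-- The walk is scanned while remembering the last clique vertex and the
-- R-walk travelled since.
last-clique-vertex : ∀ {n} {P : Fin n → Set} {R a y} → P a → Star (WithClique P R) a y →
                     Σ (Fin n) λ z → P z × Star R z y
last-clique-vertex {n} Pa = scan Pa ε
  where
  scan : ∀ {P R z b y} → P z → Star R z b → Star (WithClique P R) b y → Σ (Fin n) λ z′ → P z′ × Star R z′ y
  scan Pz since ε = _ , Pz , since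
  scan Pz since (inj₁ (_ , Pc) ◅ walk) = scan Pc ε walk
  scan Pz since (inj₂ r ◅ walk) = scan Pz (since ◅◅ r ◅ ε) walk

module _ {n : ℕ} (G : Digraph n) {𝒞 : Subset n → Set} {B : Subset n} (bB : IsVRBlock G B)
         (others : ∀ {C} → 𝒞 C → IsVRBlock G C × B ≢ C) where

  -- A clique P inside a block B cannot reach a vertex of B outside P
  -- through the other blocks: this is acyclicity, applied to the last
  -- clique vertex of the walk.
  no-entry : ∀ {P} → (∀ {y} → P y → y ∈ B) → ∀ {a y} → P a → ¬ P y → y ∈ B →
             ¬ Star (WithClique P (Linked 𝒞)) a y
  no-entry P⊆B Pa ¬Py y∈B walk with last-clique-vertex Pa walk
  ... | z , Pz , plain = no-detour G bB others (P⊆B Pz) y∈B (λ { refl → ¬Py Pz }) plain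

  module _ {b₀ : Fin n} (b₀∈B : b₀ ∈ B) where

    joinable? : ∀ y → Dec (y ∈ B × y ≢ b₀)
    joinable? y = (y ∈? B) ×-dec ¬? (y ≟ b₀)

    joinable-count : suc (∑ (indicator ∘ joinable?)) ≡ ∣ B ∣
    joinable-count = trans (∑-raise _ _ b₀ agree (indicator-no (λ (_ , b₀≢b₀) → b₀≢b₀ refl) _)
                                                  (indicator-yes b₀∈B _))
                           (sym (∣∣≡∑ B))
      where
      agree : ∀ y → y ≢ b₀ → indicator (joinable? y) ≡ indicator (y ∈? B)
      agree y y≢b₀ = indicator-cong proj₁ (λ y∈B → y∈B , y≢b₀) _ _

    -- While the vertices ι j are pending, the vertices already in the class
    -- of b₀ are b₀ and the vertices of B no longer pending.
    Joined : ∀ {m} → (Fin m → Fin n) → Fin n → Set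
    Joined ι y = y ≡ b₀ ⊎ (y ∈ B × ∀ j → ι j ≢ y)

    joined⊆B : ∀ {m} {ι : Fin m → Fin n} {y} → Joined ι y → y ∈ B
    joined⊆B (inj₁ refl) = b₀∈B
    joined⊆B (inj₂ (y∈B , _)) = y∈B

    stay-joined : ∀ {m} {ι : Fin (suc m) → Fin n} {a b} →
                  WithClique (Joined ι) (Linked 𝒞) a b → WithClique (Joined (ι ∘ suc)) (Linked 𝒞) a b
    stay-joined {ι = ι} (inj₁ (Ja , Jb)) = inj₁ (stay Ja , stay Jb)
      where
      stay : ∀ {y} → Joined ι y → Joined (ι ∘ suc) y
      stay (inj₁ y≡b₀) = inj₁ y≡b₀
      stay (inj₂ (y∈B , not-pending)) = inj₂ (y∈B , not-pending ∘ suc)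
    stay-joined (inj₂ linked) = inj₂ linked

    -- Joining the pending vertices one at a time: each joinable one lies in
    -- a class different from that of b₀ (by `no-entry`), so joining it
    -- removes a class.
    absorb-pending : ∀ {m} (ι : Fin m → Fin n) → Injective _≡_ _≡_ ι →
      ∀ {f} → Labelling (WithClique (Joined ι) (Linked 𝒞)) f →
      Σ (Fin n → Fin n) λ f′ → Labelling (WithClique (_∈ B) (Linked 𝒞)) f′ ×
        classes f′ + ∑ (indicator ∘ joinable? ∘ ι) ≤ classes f
    absorb-pending {zero} ι inj {f} L =
      f , labelling-map finish L , ℕ.≤-reflexive (ℕ.+-identityʳ (classes f))
      where
      finish : ∀ {a b} → WithClique (Joined ι) (Linked 𝒞) a b → WithClique (_∈ B) (Linked 𝒞) a b
      finish (inj₁ (Ja , Jb)) = inj₁ (joined⊆B Ja , joined⊆B Jb)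
      finish (inj₂ linked) = inj₂ linked
    absorb-pending {suc m} ι inj {f} L with joinable? (ι zero)
    ... | no _ = absorb-pending (ι ∘ suc) (suc-injective ∘ inj) (labelling-map stay-joined L)
    ... | yes (x∈B , x≢b₀) =
      let f′ , L′ , bound = absorb-pending (ι ∘ suc) (suc-injective ∘ inj)
                              (labelling (inj₁ (x-joined , inj₁ refl)) (inj₁ (inj₁ refl , x-joined)))
      in f′ , L′ , (begin
        classes f′ + suc (∑ (indicator ∘ joinable? ∘ ι ∘ suc)) ≡⟨ ℕ.+-suc (classes f′) _ ⟩
        suc (classes f′ + ∑ (indicator ∘ joinable? ∘ ι ∘ suc)) ≤⟨ s≤s bound ⟩
        suc (classes joined)                                    ≡⟨ one-class-fewer ⟩
        classes f                                               ∎)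
      where
      open ℕ.≤-Reasoning
      x : Fin n
      x = ι zero
      x-joined : Joined (ι ∘ suc) x
      x-joined = inj₂ (x∈B , λ j ιsj≡x → 0≢1+n (inj (sym ιsj≡x)))
      x-pending : ¬ Joined ι x
      x-pending (inj₁ x≡b₀) = x≢b₀ x≡b₀
      x-pending (inj₂ (_ , not-pending)) = not-pending zero refl
      separate : f x ≢ f b₀
      separate same = no-entry joined⊆B (inj₁ refl) x-pending x∈B (Labelling.connected L b₀ x (sym same))
      open Join (labelling-map stay-joined L) separate

    absorb-block : ∀ {f} → Labelling (Linked 𝒞) f →
      Σ (Fin n → Fin n) λ f′ → Labelling (Linked (λ C → C ≡ B ⊎ 𝒞 C)) f′ ×
        classes f′ + (∣ B ∣ ∸ 1) ≤ classes f
    absorb-block L with absorb-pending id id (labelling-map inj₂ L)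
    ... | f′ , L′ , bound =
      f′ , labelling-map as-block L′ , subst (λ k → classes f′ + k ≤ _) (cong (_∸ 1) joinable-count) bound
      where
      as-block : ∀ {a b} → WithClique (_∈ B) (Linked 𝒞) a b → Linked (λ C → C ≡ B ⊎ 𝒞 C) a b
      as-block (inj₁ (a∈B , b∈B)) = B , inj₁ refl , a∈B , b∈B
      as-block (inj₂ (C , C∈𝒞 , a∈C , b∈C)) = C , inj₂ C∈𝒞 , a∈C , b∈C

excess : ∀ {n} → List (Subset n) → ℕ
excess Bs = sum (map (λ B → ∣ B ∣ ∸ 1) Bs)

absorb-blocks : ∀ {n} (G : Digraph n) (Bs : List (Subset n)) → Unique Bs → All (IsVRBlock G) Bs →
  Σ (Fin n → Fin n) λ f → Labelling (Linked (_∈ₗ Bs)) f × classes f + excess Bs ≤ n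
absorb-blocks G [] _ _ = id , identity-labelling , ℕ.≤-trans (ℕ.≤-reflexive (ℕ.+-identityʳ _)) (classes≤n id)
absorb-blocks G (B ∷ Bs) (B∉Bs ∷ unique) (bB ∷ bBs) =
  let f , L , bound = absorb-blocks G Bs unique bBs
      _ , b₀∈B = element B (ℕ.≤-trans (s≤s z≤n) (proj₁ bB))
      f′ , L′ , bound′ = absorb-block G bB others b₀∈B L
  in f′ , labelling-map in-list L′ , (begin
    classes f′ + (∣ B ∣ ∸ 1 + excess Bs) ≡⟨ ℕ.+-assoc (classes f′) _ _ ⟨
    classes f′ + (∣ B ∣ ∸ 1) + excess Bs ≤⟨ ℕ.+-monoˡ-≤ (excess Bs) bound′ ⟩
    classes f + excess Bs                ≤⟨ bound ⟩
    _                                    ∎)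
  where
  open ℕ.≤-Reasoning
  others : ∀ {C} → C ∈ₗ Bs → IsVRBlock G C × B ≢ C
  others C∈Bs = lookup bBs C∈Bs , λ { refl → lookup B∉Bs C∈Bs refl }
  in-list : ∀ {a b} → Linked (λ C → C ≡ B ⊎ C ∈ₗ Bs) a b → Linked (_∈ₗ B ∷ Bs) a b
  in-list (C , inj₁ C≡B , a∈C , b∈C) = C , here C≡B , a∈C , b∈C
  in-list (C , inj₂ C∈Bs , a∈C , b∈C) = C , there C∈Bs , a∈C , b∈C

size≤2*excess : ∀ {n} (Bs : List (Subset n)) → All (λ B → 2 ≤ ∣ B ∣) Bs → sum (map ∣_∣ Bs) ≤ 2 * excess Bs
size≤2*excess [] [] = z≤n
size≤2*excess (B ∷ Bs) (2≤∣B∣ ∷ large) = begin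
  ∣ B ∣ + sum (map ∣_∣ Bs)             ≤⟨ ℕ.+-mono-≤ (k≤2*[k∸1] 2≤∣B∣) (size≤2*excess Bs large) ⟩
  2 * (∣ B ∣ ∸ 1) + 2 * excess Bs      ≡⟨ ℕ.*-distribˡ-+ 2 (∣ B ∣ ∸ 1) (excess Bs) ⟨
  2 * (∣ B ∣ ∸ 1 + excess Bs)          ∎
  where
  open ℕ.≤-Reasoning
  k≤2*[k∸1] : ∀ {k} → 2 ≤ k → k ≤ 2 * (k ∸ 1)
  k≤2*[k∸1] {suc zero} (s≤s ())
  k≤2*[k∸1] {suc (suc j)} _ = s≤s (subst (λ t → suc j ≤ j + suc t) (sym (ℕ.+-identityʳ j)) (ℕ.m≤n+m (suc j) j))

lemma5 : ∀ (n : ℕ) (G : Digraph n) (Bs : List (Subset n)) →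
    Unique Bs → All (IsVRBlock G) Bs →
    sum (map ∣_∣ Bs) ≤ 2 * n ∸ 2
lemma5 n G Bs unique blocks with absorb-blocks G Bs unique blocks
... | f , L , bound = begin
  sum (map ∣_∣ Bs)  ≤⟨ size≤2*excess Bs (all-map proj₁ blocks) ⟩
  2 * excess Bs     ≤⟨ ℕ.*-monoʳ-≤ 2 (merges-bound (excess Bs) L bound) ⟩
  2 * (n ∸ 1)       ≡⟨ ℕ.*-distribˡ-∸ 2 n 1 ⟩
  2 * n ∸ 2         ∎
  where open ℕ.≤-Reasoning
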